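{- For every finite directed graph $G$ with a $k$-dimensional weight function $w$ and every mean-payoff expression $F$ over $k$ dimensions, one can effectively construct an $m$-dimensional weight function $w'$ on the edges of $G$ and a mean-payoff expression $F'$ in normal form such that every infinite path $\pi$ in $G$ satisfies $F(w(\pi))=F'(w'(\pi))$.
   Context: For $\rho=a_1a_2\dots\in(\mathbb{R}^k)^\omega$, $\mathrm{LimInfAvg}_i(\rho)=\liminf_n\frac1n\sum_{j\le n}(a_j)_i$, $\mathrm{LimSupAvg}_i(\rho)=\limsup_n\frac1n\sum_{j\le n}(a_j)_i$. Mean-payoff expressions are generated from the atomic expressions $\mathrm{LimInfAvg}_i$, $\mathrm{LimSupAvg}_i$ by numerical complement ($-E$), $\mathrm{MAX}$, $\mathrm{MIN}$ and $\mathrm{SUM}$, with pointwise semantics; $w(\pi)$ denotes the sequence of weights of the edges of a path $\pi$. An expression is in normal form if (i) numerical complement does not occur in it; (ii) for every dimension $i$ there is at most one occurrence of an atomic expression in $\{\mathrm{LimInfAvg}_i,\mathrm{LimSupAvg}_i\}$; and (iii) it is of the form $\mathrm{MAX}(E_1,\dots,E_\ell)$ where each $E_j$ is max-free (the $\mathrm{MAX}$ operator does not occur in $E_j$).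
   Formalization: The weight function w takes values in ℚ^k rather than ℝ^k, and the constructed weight function w′ is rational as well. -}

module Defs where

open import Data.Nat as ℕ using (ℕ; zero; suc)
open import Data.Integer using (ℤ; +_)
open import Data.Rational using (ℚ; _+_; _*_; -_; _≤_; _<_; _/_; 0ℚ)
open import Data.Fin using (Fin)
open import Data.Product using (Σ; ∃; _×_; _,_)
open import Data.Sum using (_⊎_)
open import Relation.Binary.PropositionalEquality using (_≡_)
open import Function.Bundles using (_⇔_)
import Data.Fin
import Relation.Nullary

record Graph (n e : ℕ) : Set where
  field
    src : Fin e → Fin n
    tgt : Fin e → Fin n
open Graph public

IsInfinitePath : ∀ {n e} → Graph n e → (ℕ → Fin e) → Set
IsInfinitePath G π = ∀ j → tgt G (π j) ≡ src G (π (suc j))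

Weight : ℕ → ℕ → Set
Weight e k = Fin e → Fin k → ℚ

weightsOf : ∀ {e k} → Weight e k → (ℕ → Fin e) → ℕ → Fin k → ℚ
weightsOf w π j = w (π j)

-- Averages: avg a n = (a₀ + … + aₙ) / (n+1)   (the average of the first n+1 entries)

prefixSum : (ℕ → ℚ) → ℕ → ℚ
prefixSum a zero    = a zero
prefixSum a (suc n) = prefixSum a n + a (suc n)

avg : (ℕ → ℚ) → ℕ → ℚ
avg a n = prefixSum a n * ((+ 1) / suc n)

-- Dedekind-cut semantics of liminf / limsup of the averages.
-- "q < liminf avg"  and  "liminf avg < q"  etc.
LimInfAbove : (ℕ → ℚ) → ℚ → Set   -- q < LimInfAvg a
LimInfAbove a q = Σ ℚ λ r → q < r × Σ ℕ λ N → ∀ n → N ℕ.≤ n → r ≤ avg a n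

LimInfBelow : (ℕ → ℚ) → ℚ → Set   -- LimInfAvg a < q
LimInfBelow a q = Σ ℚ λ r → r < q × (∀ N → Σ ℕ λ n → N ℕ.≤ n × avg a n ≤ r)

LimSupAbove : (ℕ → ℚ) → ℚ → Set   -- q < LimSupAvg a
LimSupAbove a q = Σ ℚ λ r → q < r × (∀ N → Σ ℕ λ n → N ℕ.≤ n × r ≤ avg a n)

LimSupBelow : (ℕ → ℚ) → ℚ → Set   -- LimSupAvg a < q
LimSupBelow a q = Σ ℚ λ r → r < q × Σ ℕ λ N → ∀ n → N ℕ.≤ n → avg a n ≤ r

data Expr (k : ℕ) : Set where
  LimInfAvg : Fin k → Expr k
  LimSupAvg : Fin k → Expr k
  NEG       : Expr k → Expr k
  MAX       : Expr k → Expr k → Expr k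
  MIN       : Expr k → Expr k → Expr k
  SUM       : Expr k → Expr k → Expr k

-- Semantics, as a (two-sided) Dedekind cut:
--   Lower E ρ q  means  q < E(ρ),   Upper E ρ q  means  E(ρ) < q.
dim : ∀ {k} → (ℕ → Fin k → ℚ) → Fin k → ℕ → ℚ
dim ρ i j = ρ j i

Lower Upper : ∀ {k} → Expr k → (ℕ → Fin k → ℚ) → ℚ → Set
Lower (LimInfAvg i) ρ q = LimInfAbove (dim ρ i) q
Lower (LimSupAvg i) ρ q = LimSupAbove (dim ρ i) q
Lower (NEG E)       ρ q = Upper E ρ (- q)
Lower (MAX E₁ E₂)   ρ q = Lower E₁ ρ q ⊎ Lower E₂ ρ q
Lower (MIN E₁ E₂)   ρ q = Lower E₁ ρ q × Lower E₂ ρ q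
Lower (SUM E₁ E₂)   ρ q = Σ ℚ λ r → Σ ℚ λ s → Lower E₁ ρ r × Lower E₂ ρ s × q ≤ r + s
Upper (LimInfAvg i) ρ q = LimInfBelow (dim ρ i) q
Upper (LimSupAvg i) ρ q = LimSupBelow (dim ρ i) q
Upper (NEG E)       ρ q = Lower E ρ (- q)
Upper (MAX E₁ E₂)   ρ q = Upper E₁ ρ q × Upper E₂ ρ q
Upper (MIN E₁ E₂)   ρ q = Upper E₁ ρ q ⊎ Upper E₂ ρ q
Upper (SUM E₁ E₂)   ρ q = Σ ℚ λ r → Σ ℚ λ s → Upper E₁ ρ r × Upper E₂ ρ s × r + s ≤ q

-- Equality of the (real) values E(ρ) and E'(ρ'): equal cuts.
SameValue : ∀ {k m} → Expr k → (ℕ → Fin k → ℚ) → Expr m → (ℕ → Fin m → ℚ) → Set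
SameValue E ρ E' ρ' = ∀ q → (Lower E ρ q ⇔ Lower E' ρ' q) × (Upper E ρ q ⇔ Upper E' ρ' q)

data ComplementFree {k} : Expr k → Set where
  cf-inf : ∀ i → ComplementFree (LimInfAvg i)
  cf-sup : ∀ i → ComplementFree (LimSupAvg i)
  cf-max : ∀ {E₁ E₂} → ComplementFree E₁ → ComplementFree E₂ → ComplementFree (MAX E₁ E₂)
  cf-min : ∀ {E₁ E₂} → ComplementFree E₁ → ComplementFree E₂ → ComplementFree (MIN E₁ E₂)
  cf-sum : ∀ {E₁ E₂} → ComplementFree E₁ → ComplementFree E₂ → ComplementFree (SUM E₁ E₂)

occ : ∀ {k} → Fin k → Expr k → ℕ
occ i (LimInfAvg j) with Data.Fin._≟_ i j
... | Relation.Nullary.yes _ = 1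
... | Relation.Nullary.no  _ = 0
occ i (LimSupAvg j) with Data.Fin._≟_ i j
... | Relation.Nullary.yes _ = 1
... | Relation.Nullary.no  _ = 0
occ i (NEG E)     = occ i E
occ i (MAX E₁ E₂) = occ i E₁ ℕ.+ occ i E₂
occ i (MIN E₁ E₂) = occ i E₁ ℕ.+ occ i E₂
occ i (SUM E₁ E₂) = occ i E₁ ℕ.+ occ i E₂

data MaxFree {k} : Expr k → Set where
  mf-inf : ∀ i → MaxFree (LimInfAvg i)
  mf-sup : ∀ i → MaxFree (LimSupAvg i)
  mf-neg : ∀ {E} → MaxFree E → MaxFree (NEG E)
  mf-min : ∀ {E₁ E₂} → MaxFree E₁ → MaxFree E₂ → MaxFree (MIN E₁ E₂)
  mf-sum : ∀ {E₁ E₂} → MaxFree E₁ → MaxFree E₂ → MaxFree (SUM E₁ E₂)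

-- (iii) MAX(E₁,…,E_ℓ) with each Eⱼ max-free (MAX is binary here, so this
-- is a MAX-tree whose leaves are max-free; ℓ = 1 is a single max-free leaf)
data MaxOfMaxFree {k} : Expr k → Set where
  leaf : ∀ {E} → MaxFree E → MaxOfMaxFree E
  node : ∀ {E₁ E₂} → MaxOfMaxFree E₁ → MaxOfMaxFree E₂ → MaxOfMaxFree (MAX E₁ E₂)

NormalForm : ∀ {k} → Expr k → Set
NormalForm E = ComplementFree E × (∀ i → occ i E ℕ.≤ 1) × MaxOfMaxFree E

-- Negations are pushed down to the atoms using −liminf a = limsup (−a) and −limsup a = liminf (−a),
-- so that a negated atom reads a negated copy of its dimension. MIN and SUM distribute over MAX
-- (for SUM because upper cuts are upward closed), so every MAX can be pulled up to the root, leaving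
-- a MAX of max-free expressions. Finally each atom occurrence gets a dimension of its own, carrying
-- a copy of the weights it reads, so that no dimension occurs twice.
module Submission where

open import Defs
open import Data.Nat using (ℕ; zero; suc)
open import Data.Fin using (Fin; zero; _↑ˡ_; _↑ʳ_; splitAt; _≟_)
open import Data.Product using (Σ; _×_; _,_; proj₁; proj₂)

import Data.Nat as ℕ
import Data.Nat.Properties as ℕ
open import Data.Bool using (Bool; true; false; not)
open import Data.Empty using (⊥-elim)
open import Data.Fin.Properties
  using (↑ˡ-injective; ↑ʳ-injective; splitAt-↑ˡ; splitAt-↑ʳ; splitAt⁻¹-↑ˡ; splitAt⁻¹-↑ʳ)
import Data.Product as Product
open import Data.Product.Algebra using (×-distribˡ-⊎)
open import Data.Product.Function.NonDependent.Propositional using (_×-⇔_)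
open import Data.Integer using (+_)
open import Data.Rational using (ℚ; _+_; _*_; -_; _/_; _≤_; _<_)
import Data.Rational.Properties as ℚ
open import Data.Sum using (_⊎_; inj₁; inj₂; [_,_]′)
import Data.Sum as Sum
open import Data.Sum.Function.Propositional using (_⊎-⇔_)
open import Algebra.Properties.Group ℚ.+-0-group using () renaming (⁻¹-involutive to neg-involutive)
open import Function using (_∘_)
open import Function.Bundles using (_⇔_; mk⇔; module Equivalence)
open import Function.Definitions using (Injective)
import Function.Properties.Equivalence as ⇔
open import Function.Properties.Inverse using (↔⇒⇔)
open import Level using (0ℓ) renaming (suc to lsuc)
open import Relation.Binary.Bundles using (Setoid)
open import Relation.Binary.PropositionalEquality using (_≡_; _≢_; refl; sym; trans; cong; cong₂; subst)
open import Relation.Nullary using (yes; no)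

x≤-y⇒y≤-x : ∀ {x y} → x ≤ - y → y ≤ - x
x≤-y⇒y≤-x {x} {y} h = subst (_≤ - x) (neg-involutive y) (ℚ.neg-antimono-≤ h)

-x≤y⇒-y≤x : ∀ {x y} → - x ≤ y → - y ≤ x
-x≤y⇒-y≤x {x} {y} h = subst (- y ≤_) (neg-involutive x) (ℚ.neg-antimono-≤ h)

x<-y⇒y<-x : ∀ {x y} → x < - y → y < - x
x<-y⇒y<-x {x} {y} h = subst (_< - x) (neg-involutive y) (ℚ.neg-antimono-< h)

-x<y⇒-y<x : ∀ {x y} → - x < y → - y < x
-x<y⇒-y<x {x} {y} h = subst (- y <_) (neg-involutive x) (ℚ.neg-antimono-< h)

negate : (ℕ → ℚ) → ℕ → ℚ
negate a j = - a j

prefixSum-negate : ∀ a n → prefixSum (negate a) n ≡ - prefixSum a n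
prefixSum-negate a zero    = refl
prefixSum-negate a (suc n) =
  trans (cong (_+ - a (suc n)) (prefixSum-negate a n))
        (sym (ℚ.neg-distrib-+ (prefixSum a n) (a (suc n))))

avg-negate : ∀ a n → avg (negate a) n ≡ - avg a n
avg-negate a n = trans (cong (_* (+ 1 / suc n)) (prefixSum-negate a n))
                       (sym (ℚ.neg-distribˡ-* (prefixSum a n) (+ 1 / suc n)))

-- Each averaging cut of Defs is, definitionally, Σ r, (r vs q) × Q (λ n → avg a n vs r)
-- with Q one of these two quantifiers.
Eventually Frequently : (ℕ → Set) → Set
Eventually P = Σ ℕ λ N → ∀ n → N ℕ.≤ n → P n
Frequently P = ∀ N → Σ ℕ λ n → N ℕ.≤ n × P n

Monotone : ((ℕ → Set) → Set) → Set₁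
Monotone Q = ∀ {P P′} → (∀ {n} → P n → P′ n) → Q P → Q P′

eventually-mono : Monotone Eventually
eventually-mono f (N , h) = N , λ n N≤n → f (h n N≤n)

frequently-mono : Monotone Frequently
frequently-mono f h N = let (n , N≤n , p) = h N in n , N≤n , f p

module _ {Q : (ℕ → Set) → Set} (Q-mono : Monotone Q) (a : ℕ → ℚ) (q : ℚ) where

  below-negate : (Σ ℚ λ r → r < - q × Q (λ n → avg a n ≤ r)) ⇔
                 (Σ ℚ λ r → q < r × Q (λ n → r ≤ avg (negate a) n))
  below-negate = mk⇔
    (λ (r , r<-q , h) → - r , x<-y⇒y<-x r<-q ,
       Q-mono (λ {n} p → subst (- r ≤_) (sym (avg-negate a n)) (ℚ.neg-antimono-≤ p)) h)
    (λ (r , q<r , h) → - r , ℚ.neg-antimono-< q<r ,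
       Q-mono (λ {n} p → x≤-y⇒y≤-x (subst (r ≤_) (avg-negate a n) p)) h)

  above-negate : (Σ ℚ λ r → - q < r × Q (λ n → r ≤ avg a n)) ⇔
                 (Σ ℚ λ r → r < q × Q (λ n → avg (negate a) n ≤ r))
  above-negate = mk⇔
    (λ (r , -q<r , h) → - r , -x<y⇒-y<x -q<r ,
       Q-mono (λ {n} p → subst (_≤ - r) (sym (avg-negate a n)) (ℚ.neg-antimono-≤ p)) h)
    (λ (r , r<q , h) → - r , ℚ.neg-antimono-< r<q ,
       Q-mono (λ {n} p → -x≤y⇒-y≤x (subst (_≤ r) (avg-negate a n) p)) h)

record Cut : Set₁ where
  constructor cut
  field
    lower upper : ℚ → Set
open Cut

infix 4 _≃_
_≃_ : Cut → Cut → Set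
C ≃ D = ∀ q → (lower C q ⇔ lower D q) × (upper C q ⇔ upper D q)

≃-refl : ∀ {C} → C ≃ C
≃-refl q = ⇔.refl , ⇔.refl

≃-sym : ∀ {C D} → C ≃ D → D ≃ C
≃-sym C≃D q = ⇔.sym (proj₁ (C≃D q)) , ⇔.sym (proj₂ (C≃D q))

≃-trans : ∀ {C D E} → C ≃ D → D ≃ E → C ≃ E
≃-trans C≃D D≃E q = ⇔.trans (proj₁ (C≃D q)) (proj₁ (D≃E q)) , ⇔.trans (proj₂ (C≃D q)) (proj₂ (D≃E q))

≃-setoid : Setoid (lsuc 0ℓ) 0ℓ
≃-setoid = record
  { Carrier       = Cut
  ; _≈_           = _≃_
  ; isEquivalence = record { refl = ≃-refl ; sym = ≃-sym ; trans = ≃-trans }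
  }

liminfᶜ limsupᶜ : (ℕ → ℚ) → Cut
liminfᶜ a = cut (LimInfAbove a) (LimInfBelow a)
limsupᶜ a = cut (LimSupAbove a) (LimSupBelow a)

SumCut : (ℚ → Set) → (ℚ → Set) → (ℚ → Set) → Set
SumCut A B R = Σ ℚ λ r → Σ ℚ λ s → A r × B s × R (r + s)

negᶜ : Cut → Cut
negᶜ C = cut (λ q → upper C (- q)) (λ q → lower C (- q))

maxᶜ minᶜ sumᶜ : Cut → Cut → Cut
maxᶜ C D = cut (λ q → lower C q ⊎ lower D q) (λ q → upper C q × upper D q)
minᶜ C D = cut (λ q → lower C q × lower D q) (λ q → upper C q ⊎ upper D q)
sumᶜ C D = cut (λ q → SumCut (lower C) (lower D) (q ≤_)) (λ q → SumCut (upper C) (upper D) (_≤ q))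

⟦_⟧ : ∀ {k} → Expr k → (ℕ → Fin k → ℚ) → Cut
⟦ E ⟧ ρ = cut (Lower E ρ) (Upper E ρ)

SumCut-cong : ∀ {A A′ B B′ : ℚ → Set} (R : ℚ → Set) →
  (∀ r → A r ⇔ A′ r) → (∀ s → B s ⇔ B′ s) → SumCut A B R ⇔ SumCut A′ B′ R
SumCut-cong R A⇔A′ B⇔B′ = mk⇔
  (λ (r , s , x , y , p) → r , s , Equivalence.to (A⇔A′ r) x , Equivalence.to (B⇔B′ s) y , p)
  (λ (r , s , x , y , p) → r , s , Equivalence.from (A⇔A′ r) x , Equivalence.from (B⇔B′ s) y , p)

maxᶜ-cong : ∀ {C C′ D D′} → C ≃ C′ → D ≃ D′ → maxᶜ C D ≃ maxᶜ C′ D′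
maxᶜ-cong C≃ D≃ q = (proj₁ (C≃ q) ⊎-⇔ proj₁ (D≃ q)) , (proj₂ (C≃ q) ×-⇔ proj₂ (D≃ q))

minᶜ-cong : ∀ {C C′ D D′} → C ≃ C′ → D ≃ D′ → minᶜ C D ≃ minᶜ C′ D′
minᶜ-cong C≃ D≃ q = (proj₁ (C≃ q) ×-⇔ proj₁ (D≃ q)) , (proj₂ (C≃ q) ⊎-⇔ proj₂ (D≃ q))

sumᶜ-cong : ∀ {C C′ D D′} → C ≃ C′ → D ≃ D′ → sumᶜ C D ≃ sumᶜ C′ D′
sumᶜ-cong C≃ D≃ q = SumCut-cong (q ≤_) (proj₁ ∘ C≃) (proj₁ ∘ D≃)
                  , SumCut-cong (_≤ q) (proj₂ ∘ C≃) (proj₂ ∘ D≃)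

negᶜ-liminfᶜ : ∀ a → negᶜ (liminfᶜ a) ≃ limsupᶜ (negate a)
negᶜ-liminfᶜ a q = below-negate frequently-mono a q , above-negate eventually-mono a q

negᶜ-limsupᶜ : ∀ a → negᶜ (limsupᶜ a) ≃ liminfᶜ (negate a)
negᶜ-limsupᶜ a q = below-negate eventually-mono a q , above-negate frequently-mono a q

negᶜ-involutive : ∀ C → negᶜ (negᶜ C) ≃ C
negᶜ-involutive C q = subst (λ x → lower C x ⇔ lower C q) (sym (neg-involutive q)) ⇔.refl
                    , subst (λ x → upper C x ⇔ upper C q) (sym (neg-involutive q)) ⇔.refl

SumCut-negate : ∀ {A B : ℚ → Set} (R R′ : ℚ → Set) →
  (∀ r s → R (r + s) → R′ (- r + - s)) → (∀ r s → R′ (r + s) → R (- r + - s)) →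
  SumCut A B R ⇔ SumCut (A ∘ -_) (B ∘ -_) R′
SumCut-negate {A} {B} R R′ f g = mk⇔
  (λ (r , s , x , y , p) → - r , - s , subst A (sym (neg-involutive r)) x ,
                                       subst B (sym (neg-involutive s)) y , f r s p)
  (λ (r , s , x , y , p) → - r , - s , x , y , g r s p)

negᶜ-sumᶜ : ∀ C D → negᶜ (sumᶜ C D) ≃ sumᶜ (negᶜ C) (negᶜ D)
negᶜ-sumᶜ C D q = SumCut-negate (_≤ - q) (q ≤_) f₁ g₁ , SumCut-negate (- q ≤_) (_≤ q) f₂ g₂
  where
  f₁ : ∀ r s → r + s ≤ - q → q ≤ - r + - s
  f₁ r s h = subst (q ≤_) (ℚ.neg-distrib-+ r s) (x≤-y⇒y≤-x h)
  g₁ : ∀ r s → q ≤ r + s → - r + - s ≤ - q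
  g₁ r s h = subst (_≤ - q) (ℚ.neg-distrib-+ r s) (ℚ.neg-antimono-≤ h)
  f₂ : ∀ r s → - q ≤ r + s → - r + - s ≤ q
  f₂ r s h = subst (_≤ q) (ℚ.neg-distrib-+ r s) (-x≤y⇒-y≤x h)
  g₂ : ∀ r s → r + s ≤ q → - q ≤ - r + - s
  g₂ r s h = subst (- q ≤_) (ℚ.neg-distrib-+ r s) (ℚ.neg-antimono-≤ h)

UpperClosed : Cut → Set
UpperClosed C = ∀ {q q′} → q ≤ q′ → upper C q → upper C q′

liminfᶜ-upperClosed : ∀ a → UpperClosed (liminfᶜ a)
liminfᶜ-upperClosed a q≤q′ (r , r<q , h) = r , ℚ.<-≤-trans r<q q≤q′ , h

limsupᶜ-upperClosed : ∀ a → UpperClosed (limsupᶜ a)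
limsupᶜ-upperClosed a q≤q′ (r , r<q , h) = r , ℚ.<-≤-trans r<q q≤q′ , h

maxᶜ-upperClosed : ∀ C D → UpperClosed C → UpperClosed D → UpperClosed (maxᶜ C D)
maxᶜ-upperClosed C D C↑ D↑ q≤q′ (x , y) = C↑ q≤q′ x , D↑ q≤q′ y

minᶜ-upperClosed : ∀ C D → UpperClosed C → UpperClosed D → UpperClosed (minᶜ C D)
minᶜ-upperClosed C D C↑ D↑ q≤q′ = Sum.map (C↑ q≤q′) (D↑ q≤q′)

sumᶜ-upperClosed : ∀ C D → UpperClosed (sumᶜ C D)
sumᶜ-upperClosed C D q≤q′ (r , s , x , y , p) = r , s , x , y , ℚ.≤-trans p q≤q′

⊎-distribˡ-× : ∀ {A B C : Set} → (A ⊎ (B × C)) ⇔ ((A ⊎ B) × (A ⊎ C))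
⊎-distribˡ-× = mk⇔ [ (λ a → inj₁ a , inj₁ a) , Product.map inj₂ inj₂ ]′ from
  where
  from : ∀ {A B C : Set} → (A ⊎ B) × (A ⊎ C) → A ⊎ (B × C)
  from (inj₁ a , _)     = inj₁ a
  from (inj₂ _ , inj₁ a) = inj₁ a
  from (inj₂ b , inj₂ c) = inj₂ (b , c)

minᶜ-distribˡ-maxᶜ : ∀ C D E → minᶜ C (maxᶜ D E) ≃ maxᶜ (minᶜ C D) (minᶜ C E)
minᶜ-distribˡ-maxᶜ C D E q = ↔⇒⇔ (×-distribˡ-⊎ 0ℓ _ _ _) , ⊎-distribˡ-×

sumᶜ-distribˡ-maxᶜ : ∀ C {D E} → UpperClosed D → UpperClosed E →
                     sumᶜ C (maxᶜ D E) ≃ maxᶜ (sumᶜ C D) (sumᶜ C E)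
sumᶜ-distribˡ-maxᶜ C {D} {E} D↑ E↑ q = mk⇔ lower-to lower-from , mk⇔ upper-to upper-from
  where
  lower-to : lower (sumᶜ C (maxᶜ D E)) q → lower (maxᶜ (sumᶜ C D) (sumᶜ C E)) q
  lower-to (r , s , x , inj₁ y , p) = inj₁ (r , s , x , y , p)
  lower-to (r , s , x , inj₂ z , p) = inj₂ (r , s , x , z , p)
  lower-from : lower (maxᶜ (sumᶜ C D) (sumᶜ C E)) q → lower (sumᶜ C (maxᶜ D E)) q
  lower-from (inj₁ (r , s , x , y , p)) = r , s , x , inj₁ y , p
  lower-from (inj₂ (r , s , x , z , p)) = r , s , x , inj₂ z , p
  upper-to : upper (sumᶜ C (maxᶜ D E)) q → upper (maxᶜ (sumᶜ C D) (sumᶜ C E)) q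
  upper-to (r , s , x , (y , z) , p) = (r , s , x , y , p) , (r , s , x , z , p)
  -- Of the two decompositions of q, the one with the larger right summand bounds both D and E.
  upper-from : upper (maxᶜ (sumᶜ C D) (sumᶜ C E)) q → upper (sumᶜ C (maxᶜ D E)) q
  upper-from ((r , s , x , y , p) , (r′ , s′ , x′ , z , p′)) with ℚ.≤-total s s′
  ... | inj₁ s≤s′ = r′ , s′ , x′ , (D↑ s≤s′ y , z) , p′
  ... | inj₂ s′≤s = r , s , x , (y , E↑ s′≤s z) , p

minᶜ-comm : ∀ C D → minᶜ C D ≃ minᶜ D C
minᶜ-comm C D q = mk⇔ Product.swap Product.swap , mk⇔ Sum.swap Sum.swap

SumCut-comm : ∀ {A B : ℚ → Set} (R : ℚ → Set) → SumCut A B R → SumCut B A R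
SumCut-comm R (r , s , x , y , p) = s , r , y , x , subst R (ℚ.+-comm r s) p

sumᶜ-comm : ∀ C D → sumᶜ C D ≃ sumᶜ D C
sumᶜ-comm C D q = mk⇔ (SumCut-comm (q ≤_)) (SumCut-comm (q ≤_))
                , mk⇔ (SumCut-comm (_≤ q)) (SumCut-comm (_≤ q))

data Avg : Set where
  liminf limsup : Avg

data Op : Set where
  min sum : Op

data Node : Set where
  max : Node
  op  : Op → Node

avgᶜ : Avg → (ℕ → ℚ) → Cut
avgᶜ liminf = liminfᶜ
avgᶜ limsup = limsupᶜ

opᶜ : Op → Cut → Cut → Cut
opᶜ min = minᶜ
opᶜ sum = sumᶜ

nodeᶜ : Node → Cut → Cut → Cut
nodeᶜ max    = maxᶜ
nodeᶜ (op o) = opᶜ o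

avgᶜ-upperClosed : ∀ κ a → UpperClosed (avgᶜ κ a)
avgᶜ-upperClosed liminf = liminfᶜ-upperClosed
avgᶜ-upperClosed limsup = limsupᶜ-upperClosed

nodeᶜ-upperClosed : ∀ n C D → UpperClosed C → UpperClosed D → UpperClosed (nodeᶜ n C D)
nodeᶜ-upperClosed max      = maxᶜ-upperClosed
nodeᶜ-upperClosed (op min) = minᶜ-upperClosed
nodeᶜ-upperClosed (op sum) C D _ _ = sumᶜ-upperClosed C D

opᶜ-cong : ∀ o {C C′ D D′} → C ≃ C′ → D ≃ D′ → opᶜ o C D ≃ opᶜ o C′ D′
opᶜ-cong min = minᶜ-cong
opᶜ-cong sum = sumᶜ-cong

nodeᶜ-cong : ∀ n {C C′ D D′} → C ≃ C′ → D ≃ D′ → nodeᶜ n C D ≃ nodeᶜ n C′ D′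
nodeᶜ-cong max    = maxᶜ-cong
nodeᶜ-cong (op o) = opᶜ-cong o

opᶜ-comm : ∀ o C D → opᶜ o C D ≃ opᶜ o D C
opᶜ-comm min = minᶜ-comm
opᶜ-comm sum = sumᶜ-comm

opᶜ-distribˡ-maxᶜ : ∀ o C {D E} → UpperClosed D → UpperClosed E →
                    opᶜ o C (maxᶜ D E) ≃ maxᶜ (opᶜ o C D) (opᶜ o C E)
opᶜ-distribˡ-maxᶜ min C {D} {E} _ _ = minᶜ-distribˡ-maxᶜ C D E
opᶜ-distribˡ-maxᶜ sum C             = sumᶜ-distribˡ-maxᶜ C

opᶜ-distribʳ-maxᶜ : ∀ o {C D} E → UpperClosed C → UpperClosed D →
                    opᶜ o (maxᶜ C D) E ≃ maxᶜ (opᶜ o C E) (opᶜ o D E)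
opᶜ-distribʳ-maxᶜ o {C} {D} E C↑ D↑ =
  ≃-trans (opᶜ-comm o (maxᶜ C D) E)
          (≃-trans (opᶜ-distribˡ-maxᶜ o E C↑ D↑) (maxᶜ-cong (opᶜ-comm o E C) (opᶜ-comm o E D)))

data Term (A : Set) : Set where
  atom : Avg → A → Term A
  node : Node → Term A → Term A → Term A

private
  variable
    A B : Set

⟦_⟧ᵗ : Term A → (A → ℕ → ℚ) → Cut
⟦ atom κ a   ⟧ᵗ v = avgᶜ κ (v a)
⟦ node n s t ⟧ᵗ v = nodeᶜ n (⟦ s ⟧ᵗ v) (⟦ t ⟧ᵗ v)

⟦⟧ᵗ-upperClosed : ∀ (t : Term A) v → UpperClosed (⟦ t ⟧ᵗ v)
⟦⟧ᵗ-upperClosed (atom κ a)   v = avgᶜ-upperClosed κ (v a)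
⟦⟧ᵗ-upperClosed (node n s t) v =
  nodeᶜ-upperClosed n _ _ (⟦⟧ᵗ-upperClosed s v) (⟦⟧ᵗ-upperClosed t v)

mapᵗ : (A → B) → Term A → Term B
mapᵗ f (atom κ a)   = atom κ (f a)
mapᵗ f (node n s t) = node n (mapᵗ f s) (mapᵗ f t)

⟦⟧ᵗ-map : ∀ (f : A → B) t {v w} → (∀ a → v (f a) ≡ w a) → ⟦ mapᵗ f t ⟧ᵗ v ≃ ⟦ t ⟧ᵗ w
⟦⟧ᵗ-map f (atom κ a) {v} v∘f≡w = subst (λ b → avgᶜ κ (v (f a)) ≃ avgᶜ κ b) (v∘f≡w a) ≃-refl
⟦⟧ᵗ-map f (node n s t) v∘f≡w = nodeᶜ-cong n (⟦⟧ᵗ-map f s v∘f≡w) (⟦⟧ᵗ-map f t v∘f≡w)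

signed : Bool → ℚ → ℚ
signed true  x = x
signed false x = - x

signᶜ : Bool → Cut → Cut
signᶜ true  C = C
signᶜ false C = negᶜ C

signedDim : ∀ {k} → (ℕ → Fin k → ℚ) → Bool × Fin k → ℕ → ℚ
signedDim ρ (b , i) j = signed b (ρ j i)

push : ∀ {k} → Bool → Expr k → Term (Bool × Fin k)
push true  (LimInfAvg i) = atom liminf (true , i)
push false (LimInfAvg i) = atom limsup (false , i)
push true  (LimSupAvg i) = atom limsup (true , i)
push false (LimSupAvg i) = atom liminf (false , i)
push b     (NEG E)       = push (not b) E
push true  (MAX E F)     = node max (push true E) (push true F)
push false (MAX E F)     = node (op min) (push false E) (push false F)
push true  (MIN E F)     = node (op min) (push true E) (push true F)
push false (MIN E F)     = node max (push false E) (push false F)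
push b     (SUM E F)     = node (op sum) (push b E) (push b F)

push-correct : ∀ {k} (ρ : ℕ → Fin k → ℚ) b E → ⟦ push b E ⟧ᵗ (signedDim ρ) ≃ signᶜ b (⟦ E ⟧ ρ)
push-correct ρ true  (LimInfAvg i) = ≃-refl
push-correct ρ false (LimInfAvg i) = ≃-sym (negᶜ-liminfᶜ (dim ρ i))
push-correct ρ true  (LimSupAvg i) = ≃-refl
push-correct ρ false (LimSupAvg i) = ≃-sym (negᶜ-limsupᶜ (dim ρ i))
push-correct ρ true  (NEG E)       = push-correct ρ false E
push-correct ρ false (NEG E)       =
  ≃-trans (push-correct ρ true E) (≃-sym (negᶜ-involutive (⟦ E ⟧ ρ)))
push-correct ρ true  (MAX E F)     = maxᶜ-cong (push-correct ρ true E) (push-correct ρ true F)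
push-correct ρ false (MAX E F)     = minᶜ-cong (push-correct ρ false E) (push-correct ρ false F)
push-correct ρ true  (MIN E F)     = minᶜ-cong (push-correct ρ true E) (push-correct ρ true F)
push-correct ρ false (MIN E F)     = maxᶜ-cong (push-correct ρ false E) (push-correct ρ false F)
push-correct ρ true  (SUM E F)     = sumᶜ-cong (push-correct ρ true E) (push-correct ρ true F)
push-correct ρ false (SUM E F)     =
  ≃-trans (sumᶜ-cong (push-correct ρ false E) (push-correct ρ false F))
          (≃-sym (negᶜ-sumᶜ (⟦ E ⟧ ρ) (⟦ F ⟧ ρ)))

distribˡ : Op → Term A → Term A → Term A
distribˡ o s (node max t u) = node max (distribˡ o s t) (distribˡ o s u)
distribˡ o s t              = node (op o) s t

distrib : Op → Term A → Term A → Term A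
distrib o (node max s u) t = node max (distrib o s t) (distrib o u t)
distrib o s              t = distribˡ o s t

normalise : Term A → Term A
normalise (atom κ a)        = atom κ a
normalise (node max s t)    = node max (normalise s) (normalise t)
normalise (node (op o) s t) = distrib o (normalise s) (normalise t)

module _ (v : A → ℕ → ℚ) where

  distribˡ-correct : ∀ o s t → ⟦ distribˡ o s t ⟧ᵗ v ≃ opᶜ o (⟦ s ⟧ᵗ v) (⟦ t ⟧ᵗ v)
  distribˡ-correct o s (node max t u) =
    ≃-trans (maxᶜ-cong (distribˡ-correct o s t) (distribˡ-correct o s u))
            (≃-sym (opᶜ-distribˡ-maxᶜ o _ (⟦⟧ᵗ-upperClosed t v) (⟦⟧ᵗ-upperClosed u v)))
  distribˡ-correct o s (atom _ _)        = ≃-refl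
  distribˡ-correct o s (node (op _) _ _) = ≃-refl

  distrib-correct : ∀ o s t → ⟦ distrib o s t ⟧ᵗ v ≃ opᶜ o (⟦ s ⟧ᵗ v) (⟦ t ⟧ᵗ v)
  distrib-correct o (node max s u) t =
    ≃-trans (maxᶜ-cong (distrib-correct o s t) (distrib-correct o u t))
            (≃-sym (opᶜ-distribʳ-maxᶜ o _ (⟦⟧ᵗ-upperClosed s v) (⟦⟧ᵗ-upperClosed u v)))
  distrib-correct o s@(atom _ _)        t = distribˡ-correct o s t
  distrib-correct o s@(node (op _) _ _) t = distribˡ-correct o s t

  normalise-correct : ∀ t → ⟦ normalise t ⟧ᵗ v ≃ ⟦ t ⟧ᵗ v
  normalise-correct (atom κ a)        = ≃-refl
  normalise-correct (node max s t)    = maxᶜ-cong (normalise-correct s) (normalise-correct t)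
  normalise-correct (node (op o) s t) =
    ≃-trans (distrib-correct o (normalise s) (normalise t))
            (opᶜ-cong o (normalise-correct s) (normalise-correct t))

data MaxFreeᵗ {A : Set} : Term A → Set where
  atom : ∀ κ a → MaxFreeᵗ (atom κ a)
  node : ∀ o {s t} → MaxFreeᵗ s → MaxFreeᵗ t → MaxFreeᵗ (node (op o) s t)

data MaxOfMaxFreeᵗ {A : Set} : Term A → Set where
  leaf : ∀ {t} → MaxFreeᵗ t → MaxOfMaxFreeᵗ t
  node : ∀ {s t} → MaxOfMaxFreeᵗ s → MaxOfMaxFreeᵗ t → MaxOfMaxFreeᵗ (node max s t)

distribˡ-maxOfMaxFree : ∀ o {s t : Term A} →
  MaxFreeᵗ s → MaxOfMaxFreeᵗ t → MaxOfMaxFreeᵗ (distribˡ o s t)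
distribˡ-maxOfMaxFree o ms (node mt mu) =
  node (distribˡ-maxOfMaxFree o ms mt) (distribˡ-maxOfMaxFree o ms mu)
distribˡ-maxOfMaxFree o ms (leaf mt@(atom _ _))   = leaf (node o ms mt)
distribˡ-maxOfMaxFree o ms (leaf mt@(node _ _ _)) = leaf (node o ms mt)

distrib-maxOfMaxFree : ∀ o {s t : Term A} →
  MaxOfMaxFreeᵗ s → MaxOfMaxFreeᵗ t → MaxOfMaxFreeᵗ (distrib o s t)
distrib-maxOfMaxFree o (node ms mu) mt =
  node (distrib-maxOfMaxFree o ms mt) (distrib-maxOfMaxFree o mu mt)
distrib-maxOfMaxFree o (leaf ms@(atom _ _))   mt = distribˡ-maxOfMaxFree o ms mt
distrib-maxOfMaxFree o (leaf ms@(node _ _ _)) mt = distribˡ-maxOfMaxFree o ms mt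

normalise-maxOfMaxFree : ∀ (t : Term A) → MaxOfMaxFreeᵗ (normalise t)
normalise-maxOfMaxFree (atom κ a)        = leaf (atom κ a)
normalise-maxOfMaxFree (node max s t)    =
  node (normalise-maxOfMaxFree s) (normalise-maxOfMaxFree t)
normalise-maxOfMaxFree (node (op o) s t) =
  distrib-maxOfMaxFree o (normalise-maxOfMaxFree s) (normalise-maxOfMaxFree t)

size : Term A → ℕ
size (atom _ _)   = 1
size (node _ s t) = size s ℕ.+ size t

number : (t : Term A) → Term (Fin (size t))
number (atom κ _)   = atom κ zero
number (node n s t) = node n (mapᵗ (_↑ˡ size t) (number s)) (mapᵗ (size s ↑ʳ_) (number t))

label : (t : Term A) → Fin (size t) → A
label (atom _ a)   _ = a
label (node _ s t)   = [ label s , label t ]′ ∘ splitAt (size s)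

label-↑ˡ : ∀ n (s t : Term A) i → label (node n s t) (i ↑ˡ size t) ≡ label s i
label-↑ˡ n s t i = cong [ label s , label t ]′ (splitAt-↑ˡ (size s) i (size t))

label-↑ʳ : ∀ n (s t : Term A) i → label (node n s t) (size s ↑ʳ i) ≡ label t i
label-↑ʳ n s t i = cong [ label s , label t ]′ (splitAt-↑ʳ (size s) (size t) i)

number-correct : ∀ (t : Term A) v → ⟦ number t ⟧ᵗ (v ∘ label t) ≃ ⟦ t ⟧ᵗ v
number-correct (atom κ a)   v = ≃-refl
number-correct (node n s t) v = nodeᶜ-cong n
  (≃-trans (⟦⟧ᵗ-map _ (number s) (cong v ∘ label-↑ˡ n s t)) (number-correct s v))
  (≃-trans (⟦⟧ᵗ-map _ (number t) (cong v ∘ label-↑ʳ n s t)) (number-correct t v))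

mapᵗ-maxFree : ∀ (f : A → B) {t} → MaxFreeᵗ t → MaxFreeᵗ (mapᵗ f t)
mapᵗ-maxFree f (atom κ a)   = atom κ (f a)
mapᵗ-maxFree f (node o x y) = node o (mapᵗ-maxFree f x) (mapᵗ-maxFree f y)

mapᵗ-maxOfMaxFree : ∀ (f : A → B) {t} → MaxOfMaxFreeᵗ t → MaxOfMaxFreeᵗ (mapᵗ f t)
mapᵗ-maxOfMaxFree f (leaf x)   = leaf (mapᵗ-maxFree f x)
mapᵗ-maxOfMaxFree f (node x y) = node (mapᵗ-maxOfMaxFree f x) (mapᵗ-maxOfMaxFree f y)

number-maxFree : ∀ {t : Term A} → MaxFreeᵗ t → MaxFreeᵗ (number t)
number-maxFree (atom κ a)   = atom κ zero
number-maxFree (node o x y) =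
  node o (mapᵗ-maxFree _ (number-maxFree x)) (mapᵗ-maxFree _ (number-maxFree y))

number-maxOfMaxFree : ∀ {t : Term A} → MaxOfMaxFreeᵗ t → MaxOfMaxFreeᵗ (number t)
number-maxOfMaxFree (leaf x)   = leaf (number-maxFree x)
number-maxOfMaxFree (node x y) =
  node (mapᵗ-maxOfMaxFree _ (number-maxOfMaxFree x)) (mapᵗ-maxOfMaxFree _ (number-maxOfMaxFree y))

avgExpr : ∀ {m} → Avg → Fin m → Expr m
avgExpr liminf = LimInfAvg
avgExpr limsup = LimSupAvg

nodeExpr : ∀ {m} → Node → Expr m → Expr m → Expr m
nodeExpr max      = MAX
nodeExpr (op min) = MIN
nodeExpr (op sum) = SUM

toExpr : ∀ {m} → Term (Fin m) → Expr m
toExpr (atom κ i)   = avgExpr κ i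
toExpr (node n s t) = nodeExpr n (toExpr s) (toExpr t)

toExpr-correct : ∀ {m} (t : Term (Fin m)) ρ → ⟦ toExpr t ⟧ ρ ≃ ⟦ t ⟧ᵗ (dim ρ)
toExpr-correct (atom liminf i)     ρ = ≃-refl
toExpr-correct (atom limsup i)     ρ = ≃-refl
toExpr-correct (node max s t)      ρ = maxᶜ-cong (toExpr-correct s ρ) (toExpr-correct t ρ)
toExpr-correct (node (op min) s t) ρ = minᶜ-cong (toExpr-correct s ρ) (toExpr-correct t ρ)
toExpr-correct (node (op sum) s t) ρ = sumᶜ-cong (toExpr-correct s ρ) (toExpr-correct t ρ)

toExpr-complementFree : ∀ {m} (t : Term (Fin m)) → ComplementFree (toExpr t)
toExpr-complementFree (atom liminf i)     = cf-inf i
toExpr-complementFree (atom limsup i)     = cf-sup i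
toExpr-complementFree (node max s t)      = cf-max (toExpr-complementFree s) (toExpr-complementFree t)
toExpr-complementFree (node (op min) s t) = cf-min (toExpr-complementFree s) (toExpr-complementFree t)
toExpr-complementFree (node (op sum) s t) = cf-sum (toExpr-complementFree s) (toExpr-complementFree t)

toExpr-maxFree : ∀ {m} {t : Term (Fin m)} → MaxFreeᵗ t → MaxFree (toExpr t)
toExpr-maxFree (atom liminf i) = mf-inf i
toExpr-maxFree (atom limsup i) = mf-sup i
toExpr-maxFree (node min x y)  = mf-min (toExpr-maxFree x) (toExpr-maxFree y)
toExpr-maxFree (node sum x y)  = mf-sum (toExpr-maxFree x) (toExpr-maxFree y)

toExpr-maxOfMaxFree : ∀ {m} {t : Term (Fin m)} → MaxOfMaxFreeᵗ t → MaxOfMaxFree (toExpr t)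
toExpr-maxOfMaxFree (leaf x)   = leaf (toExpr-maxFree x)
toExpr-maxOfMaxFree (node x y) = node (toExpr-maxOfMaxFree x) (toExpr-maxOfMaxFree y)

occ-avgExpr-self : ∀ {m} κ (i : Fin m) → occ i (avgExpr κ i) ≡ 1
occ-avgExpr-self liminf i with i ≟ i
... | yes _   = refl
... | no i≢i = ⊥-elim (i≢i refl)
occ-avgExpr-self limsup i with i ≟ i
... | yes _   = refl
... | no i≢i = ⊥-elim (i≢i refl)

occ-avgExpr-≢ : ∀ {m} κ {i j : Fin m} → i ≢ j → occ i (avgExpr κ j) ≡ 0
occ-avgExpr-≢ liminf {i} {j} i≢j with i ≟ j
... | yes i≡j = ⊥-elim (i≢j i≡j)
... | no _    = refl
occ-avgExpr-≢ limsup {i} {j} i≢j with i ≟ j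
... | yes i≡j = ⊥-elim (i≢j i≡j)
... | no _    = refl

occ-nodeExpr : ∀ {m} n (i : Fin m) E F → occ i (nodeExpr n E F) ≡ occ i E ℕ.+ occ i F
occ-nodeExpr max      i E F = refl
occ-nodeExpr (op min) i E F = refl
occ-nodeExpr (op sum) i E F = refl

module _ {m m′} {f : Fin m → Fin m′} where

  occ-map-injective : Injective _≡_ _≡_ f → ∀ j t → occ (f j) (toExpr (mapᵗ f t)) ≡ occ j (toExpr t)
  occ-map-injective f-inj j (atom κ l) with j ≟ l
  ... | yes refl = trans (occ-avgExpr-self κ (f j)) (sym (occ-avgExpr-self κ j))
  ... | no j≢l   = trans (occ-avgExpr-≢ κ (j≢l ∘ f-inj)) (sym (occ-avgExpr-≢ κ j≢l))
  occ-map-injective f-inj j (node n s t) =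
    trans (occ-nodeExpr n (f j) _ _)
          (trans (cong₂ ℕ._+_ (occ-map-injective f-inj j s) (occ-map-injective f-inj j t))
                 (sym (occ-nodeExpr n j _ _)))

  occ-map-outside : ∀ {i} → (∀ l → f l ≢ i) → ∀ t → occ i (toExpr (mapᵗ f t)) ≡ 0
  occ-map-outside i∉f (atom κ l)   = occ-avgExpr-≢ κ (i∉f l ∘ sym)
  occ-map-outside i∉f (node n s t) =
    trans (occ-nodeExpr n _ _ _) (cong₂ ℕ._+_ (occ-map-outside i∉f s) (occ-map-outside i∉f t))

↑ʳ≢↑ˡ : ∀ m {n} (i : Fin m) (j : Fin n) → m ↑ʳ j ≢ i ↑ˡ n
↑ʳ≢↑ˡ m {n} i j eq
  with trans (sym (splitAt-↑ʳ m n j)) (trans (cong (splitAt m) eq) (splitAt-↑ˡ m i n))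
... | ()

occ-number-↑ˡ : ∀ n (s t : Term A) j →
  occ (j ↑ˡ size t) (toExpr (number (node n s t))) ≡ occ j (toExpr (number s))
occ-number-↑ˡ n s t j =
  trans (occ-nodeExpr n _ _ _)
        (trans (cong₂ ℕ._+_ (occ-map-injective (↑ˡ-injective _ _ _) j (number s))
                            (occ-map-outside (λ l → ↑ʳ≢↑ˡ (size s) j l) (number t)))
               (ℕ.+-identityʳ _))

occ-number-↑ʳ : ∀ n (s t : Term A) j →
  occ (size s ↑ʳ j) (toExpr (number (node n s t))) ≡ occ j (toExpr (number t))
occ-number-↑ʳ n s t j =
  trans (occ-nodeExpr n _ _ _)
        (cong₂ ℕ._+_ (occ-map-outside (λ l → ↑ʳ≢↑ˡ (size s) l j ∘ sym) (number s))
                     (occ-map-injective (↑ʳ-injective _ _ _) j (number t)))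

occ-number : ∀ (t : Term A) i → occ i (toExpr (number t)) ℕ.≤ 1
occ-number (atom κ a) zero = ℕ.≤-reflexive (occ-avgExpr-self κ zero)
occ-number (node n s t) i with splitAt (size s) i in eq
... | inj₁ j with refl ← splitAt⁻¹-↑ˡ eq =
  ℕ.≤-trans (ℕ.≤-reflexive (occ-number-↑ˡ n s t j)) (occ-number s j)
... | inj₂ j with refl ← splitAt⁻¹-↑ʳ eq =
  ℕ.≤-trans (ℕ.≤-reflexive (occ-number-↑ʳ n s t j)) (occ-number t j)

lemma5 : ∀ {n e k} (G : Graph n e) (w : Weight e k) (F : Expr k) →
    Σ ℕ λ m → Σ (Weight e m) λ w′ → Σ (Expr m) λ F′ →
      NormalForm F′ ×
      (∀ (π : ℕ → Fin e) → IsInfinitePath G π →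
        SameValue F (weightsOf w π) F′ (weightsOf w′ π))
lemma5 {e = e} {k} _ w F = size t , w′ , toExpr (number t) , normal , λ π _ → correct π
  where
  t : Term (Bool × Fin k)
  t = normalise (push true F)

  w′ : Weight e (size t)
  w′ x l = let (b , i) = label t l in signed b (w x i)

  normal : NormalForm (toExpr (number t))
  normal = toExpr-complementFree (number t) , occ-number t
         , toExpr-maxOfMaxFree (number-maxOfMaxFree (normalise-maxOfMaxFree (push true F)))

  correct : ∀ π → ⟦ F ⟧ (weightsOf w π) ≃ ⟦ toExpr (number t) ⟧ (weightsOf w′ π)
  correct π = begin
    ⟦ F ⟧ ρ                                 ≈⟨ push-correct ρ true F ⟨
    ⟦ push true F ⟧ᵗ v                      ≈⟨ normalise-correct v (push true F) ⟨
    ⟦ t ⟧ᵗ v                                ≈⟨ number-correct t v ⟨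
    ⟦ number t ⟧ᵗ (v ∘ label t)             ≈⟨ toExpr-correct (number t) (weightsOf w′ π) ⟨
    ⟦ toExpr (number t) ⟧ (weightsOf w′ π)  ∎
    where
    open import Relation.Binary.Reasoning.Setoid ≃-setoid
    ρ = weightsOf w π
    v = signedDim ρ
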